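{- Let $a,b\geq 0$ and $c,d\geq 1$ be integers, let $v=a+b+c+d+1$, and let $L=\{1^a,2^b,3^c,4^d\}$ be an admissible list. If $a\geq 3$, or if $a=2$ and $b\geq 1$, then there exists a Hamiltonian path $H$ of $K_v$ with $\ell(H)=L$.
   Context: $K_v$ is the complete graph on vertex set $\{0,1,\ldots,v-1\}$. The length of an edge $[x,y]$ is $\min(|x-y|,\,v-|x-y|)$, and for a subgraph $H$, $\ell(H)$ is the list (multiset) of lengths of its edges. The notation $\{1^{a_1},\ldots,t^{a_t}\}$ denotes the multiset containing $a_i$ copies of $i$. A list $L$ of $v-1$ positive integers not exceeding $\lfloor v/2\rfloor$ is called admissible if for every divisor $d$ of $v$, the number of elements of $L$ (with multiplicity) that are multiples of $d$ is at most $v-d$. -}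

module Defs where

open import Data.Nat.Base using (ℕ; _+_; _∸_; _≤_; _⊓_; ∣_-_∣; ⌊_/2⌋)
open import Data.Nat.Divisibility using (_∣_; _∣?_)
open import Data.List.Base using (List; []; _∷_; _++_; length; filter; replicate; upTo; zipWith; drop)
open import Data.List.Relation.Unary.All using (All)
open import Data.List.Relation.Binary.Permutation.Propositional using (_↭_)
open import Data.Product using (_×_)
open import Relation.Binary.PropositionalEquality using (_≡_)

edgeLength : ℕ → ℕ → ℕ → ℕ
edgeLength v x y = ∣ x - y ∣ ⊓ (v ∸ ∣ x - y ∣)

-- A Hamiltonian path of K_v is given by the sequence of its vertices:
-- a list containing each of 0,...,v-1 exactly once (a permutation of upTo v).
IsHamiltonianPath : ℕ → List ℕ → Set
IsHamiltonianPath v p = p ↭ upTo v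

pathLengths : ℕ → List ℕ → List ℕ
pathLengths v p = zipWith (edgeLength v) p (drop 1 p)

countMultiples : ℕ → List ℕ → ℕ
countMultiples d L = length (filter (d ∣?_) L)

Admissible : ℕ → List ℕ → Set
Admissible v L =
  length L ≡ (v ∸ 1) × All (λ x → 1 ≤ x × x ≤ ⌊ v /2⌋) L ×
  (∀ d → d ∣ v → countMultiples d L ≤ v ∸ d)

L1234 : ℕ → ℕ → ℕ → ℕ → List ℕ
L1234 a b c d = replicate a 1 ++ replicate b 2 ++ replicate c 3 ++ replicate d 4

module Submission where

open import Defs
open import Data.Nat.Base using (ℕ; zero; suc; _+_; _*_; _∸_; _≤_; _<_; _<ᵇ_; _≤ᵇ_; _≡ᵇ_; _⊓_; ∣_-_∣; ⌊_/2⌋; ⌈_/2⌉; z≤n; s≤s)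
open import Data.Nat.Properties
open import Data.Bool.Base using (Bool; true; false; if_then_else_; T; _∧_)
open import Data.Bool.Properties using (T-∧; T-≡)
open import Data.Unit.Base using (⊤; tt)
open import Data.Empty using (⊥-elim)
open import Data.Maybe.Base using (Maybe; just; nothing)
import Data.Maybe.Base as Maybe
open import Data.Product using (Σ; _×_; _,_; proj₁; proj₂)
open import Data.Sum using (_⊎_; inj₁; inj₂)
open import Data.List.Base using (List; []; _∷_; _++_; map; replicate; upTo; length; [_]; zipWith; applyUpTo)
open import Data.List.Properties using (++-assoc; ++-identityʳ; map-++)
open import Data.List.Relation.Unary.All using (All; []; _∷_)
import Data.List.Relation.Unary.All as All
open import Data.List.Relation.Binary.Permutation.Propositional using (_↭_; prep; swap; ↭-refl; ↭-sym; ↭-trans; ↭-reflexive; module PermutationReasoning)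
open import Data.List.Relation.Binary.Permutation.Propositional.Properties using (++⁺ˡ; ++⁺ʳ; ++⁺; shift; shifts; ++-comm; map⁺; ↭-length; All-resp-↭)
open import Relation.Nullary using (¬_)
open import Relation.Binary.PropositionalEquality using (_≡_; refl; cong; cong₂; sym; trans; subst; module ≡-Reasoning)
open import Function.Bundles using (Equivalence)
open import Data.Nat.Solver using (module +-*-Solver)

-- A Hamiltonian path H of K_v is a permutation of 0,…,v-1; its
-- *linear* lengths are the differences |x - y| of consecutive vertices.  Since an
-- admissible list only contains lengths ≤ ⌊v/2⌋, linear and cyclic lengths agree,
-- so it suffices to find H whose difference list is a permutation of L.
-- The engine is the stretching operation (θ, t): every vertex x ≥ θ is relabelled
-- x + t, and on every edge crossing the threshold θ the upper endpoint (with its old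
-- label) is inserted.  If the upper endpoints of the crossing edges are exactly
-- θ, …, θ+t-1, the result is a Hamiltonian path on v + t vertices whose differences
-- are the old ones plus t copies of t; crossings of thresholds θ' ≤ θ are unchanged,
-- so a descending program of such steps may be repeated any number of times.
-- Every (a,b,c,d) of the theorem is therefore reached from one of 100 explicit base
-- paths (a ∈ {2,3}, b ≤ 2, c ≤ 4, d ≤ 5) by adding lengths 1,2,3,4 in blocks of
-- 1,2,3,4 copies.

remove : ℕ → List ℕ → Maybe (List ℕ)
remove x [] = nothing
remove x (y ∷ ys) = if x ≡ᵇ y then just ys else Maybe.map (y ∷_) (remove x ys)

remove-sound : ∀ x ys zs → remove x ys ≡ just zs → ys ↭ x ∷ zs
remove-sound x (y ∷ ys) zs eq with x ≡ᵇ y in x≡ᵇy | remove x ys in rest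
remove-sound x (y ∷ ys) .ys refl | true | _ rewrite ≡ᵇ⇒≡ x y (subst T (sym x≡ᵇy) tt) = ↭-refl
remove-sound x (y ∷ ys) .(y ∷ ws) refl | false | just ws =
  ↭-trans (prep y (remove-sound x ys ws rest)) (swap y x ↭-refl)

permᵇ : List ℕ → List ℕ → Bool
permᵇ [] [] = true
permᵇ [] (_ ∷ _) = false
permᵇ (x ∷ xs) ys with remove x ys
... | just zs = permᵇ xs zs
... | nothing = false

permᵇ-sound : ∀ xs ys → T (permᵇ xs ys) → xs ↭ ys
permᵇ-sound [] [] _ = ↭-refl
permᵇ-sound (x ∷ xs) ys h with remove x ys in eq
... | just zs = ↭-trans (prep x (permᵇ-sound xs zs h)) (↭-sym (remove-sound x ys zs eq))

diffsFrom : ℕ → List ℕ → List ℕ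
diffsFrom x [] = []
diffsFrom x (y ∷ r) = ∣ x - y ∣ ∷ diffsFrom y r

diffs : List ℕ → List ℕ
diffs [] = []
diffs (x ∷ r) = diffsFrom x r

cyclic : ℕ → ℕ → ℕ
cyclic v δ = δ ⊓ (v ∸ δ)

pathLengths≡map-cyclic : ∀ v H → pathLengths v H ≡ map (cyclic v) (diffs H)
pathLengths≡map-cyclic v [] = refl
pathLengths≡map-cyclic v (x ∷ r) = fromVertex x r
  where
  fromVertex : ∀ x r → zipWith (edgeLength v) (x ∷ r) r ≡ map (cyclic v) (diffsFrom x r)
  fromVertex x [] = refl
  fromVertex x (y ∷ r) = cong (cyclic v ∣ x - y ∣ ∷_) (fromVertex y r)

cyclic-short : ∀ v δ → δ ≤ ⌊ v /2⌋ → cyclic v δ ≡ δ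
cyclic-short v δ δ≤half = m≤n⇒m⊓n≡m (begin
    δ             ≤⟨ δ≤half ⟩
    ⌊ v /2⌋       ≤⟨ ⌊n/2⌋≤⌈n/2⌉ v ⟩
    ⌈ v /2⌉       ≡⟨ sym (m+n∸m≡n ⌊ v /2⌋ ⌈ v /2⌉) ⟩
    ⌊ v /2⌋ + ⌈ v /2⌉ ∸ ⌊ v /2⌋ ≡⟨ cong (_∸ ⌊ v /2⌋) (⌊n/2⌋+⌈n/2⌉≡n v) ⟩
    v ∸ ⌊ v /2⌋   ≤⟨ ∸-monoʳ-≤ v δ≤half ⟩
    v ∸ δ         ∎)
  where open ≤-Reasoning

pathLengths-short : ∀ v H → All (_≤ ⌊ v /2⌋) (diffs H) → pathLengths v H ≡ diffs H
pathLengths-short v H short = trans (pathLengths≡map-cyclic v H) (map-short short)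
  where
  map-short : ∀ {L} → All (_≤ ⌊ v /2⌋) L → map (cyclic v) L ≡ L
  map-short [] = refl
  map-short (δ≤ ∷ rest) = cong₂ _∷_ (cyclic-short v _ δ≤) (map-short rest)

interval : ℕ → ℕ → List ℕ
interval s zero = []
interval s (suc n) = s ∷ interval (suc s) n

length-interval : ∀ s n → length (interval s n) ≡ n
length-interval s zero = refl
length-interval s (suc n) = cong suc (length-interval (suc s) n)

applyUpTo≡interval : ∀ s n (f : ℕ → ℕ) → (∀ i → f i ≡ s + i) → applyUpTo f n ≡ interval s n
applyUpTo≡interval s zero f f≗ = refl
applyUpTo≡interval s (suc n) f f≗ =
  cong₂ _∷_ (trans (f≗ 0) (+-identityʳ s))
    (applyUpTo≡interval (suc s) n (λ i → f (suc i)) (λ i → trans (f≗ (suc i)) (+-suc s i)))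

upTo≡interval : ∀ n → upTo n ≡ interval 0 n
upTo≡interval n = applyUpTo≡interval 0 n (λ i → i) (λ _ → refl)

interval-++ : ∀ s m n → interval s m ++ interval (s + m) n ≡ interval s (m + n)
interval-++ s zero n = cong (λ s' → interval s' n) (+-identityʳ s)
interval-++ s (suc m) n = cong (s ∷_) (begin
    interval (suc s) m ++ interval (s + suc m) n ≡⟨ cong (λ s' → interval (suc s) m ++ interval s' n) (+-suc s m) ⟩
    interval (suc s) m ++ interval (suc s + m) n ≡⟨ interval-++ (suc s) m n ⟩
    interval (suc s) (m + n)                     ∎)
  where open ≡-Reasoning

replicate-++ : ∀ m n (x : ℕ) → replicate m x ++ replicate n x ≡ replicate (m + n) x
replicate-++ zero n x = refl
replicate-++ (suc m) n x = cong (x ∷_) (replicate-++ m n x)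

lift : ℕ → ℕ → ℕ → ℕ
lift θ t x = if x <ᵇ θ then x else x + t

crossing : ℕ → ℕ → ℕ → List ℕ
crossing θ x y = if x <ᵇ θ then (if y <ᵇ θ then [] else [ y ]) else (if y <ᵇ θ then [ x ] else [])

stretchFrom : ℕ → ℕ → ℕ → List ℕ → List ℕ
stretchFrom θ t x [] = []
stretchFrom θ t x (y ∷ r) = crossing θ x y ++ lift θ t y ∷ stretchFrom θ t y r

stretch : ℕ → ℕ → List ℕ → List ℕ
stretch θ t [] = []
stretch θ t (x ∷ r) = lift θ t x ∷ stretchFrom θ t x r

crossingsFrom : ℕ → ℕ → List ℕ → List ℕ
crossingsFrom θ x [] = []
crossingsFrom θ x (y ∷ r) = crossing θ x y ++ crossingsFrom θ y r

crossings : ℕ → List ℕ → List ℕ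
crossings θ [] = []
crossings θ (x ∷ r) = crossingsFrom θ x r

lift-by : ∀ θ t x {b} → (x <ᵇ θ) ≡ b → lift θ t x ≡ (if b then x else x + t)
lift-by θ t x refl = refl

above⇒not-below : ∀ {θ x} → θ ≤ x → (x <ᵇ θ) ≡ false
above⇒not-below {θ} {x} θ≤x with x <ᵇ θ in x<ᵇθ
... | false = refl
... | true = ⊥-elim (<⇒≱ (<ᵇ⇒< x θ (subst T (sym x<ᵇθ) tt)) θ≤x)

not-below⇒above : ∀ {θ x} → (x <ᵇ θ) ≡ false → θ ≤ x
not-below⇒above {θ} {x} x≮ᵇθ = ≮⇒≥ (λ x<θ → subst T x≮ᵇθ (<⇒<ᵇ x<θ))

crossing-above : ∀ {θ x y} → θ ≤ x → θ ≤ y → crossing θ x y ≡ []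
crossing-above θ≤x θ≤y rewrite above⇒not-below θ≤x | above⇒not-below θ≤y = refl

stretch-vertices : ∀ θ t P → stretch θ t P ↭ map (lift θ t) P ++ crossings θ P
stretch-vertices θ t [] = ↭-refl
stretch-vertices θ t (x ∷ r) = prep (lift θ t x) (fromVertex x r)
  where
  fromVertex : ∀ x r → stretchFrom θ t x r ↭ map (lift θ t) r ++ crossingsFrom θ x r
  fromVertex x [] = ↭-refl
  fromVertex x (y ∷ r) =
    ↭-trans (++⁺ˡ (crossing θ x y) (prep (lift θ t y) (fromVertex y r)))
            (shifts (crossing θ x y) (map (lift θ t) (y ∷ r)))

∣-∣-translate : ∀ x y t → ∣ x + t - y + t ∣ ≡ ∣ x - y ∣
∣-∣-translate x y t rewrite +-comm x t | +-comm y t = ∣m+n-m+o∣≡∣n-o∣ t x y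

-- The statement is phrased for an arbitrary label x' of the start vertex, so that the
-- recursive call can be transported along the computed value of `lift` (lift-by).
-- The four cases are the four positions of an edge x → y relative to θ: an edge
-- entering or leaving the upper part gains an extra edge of length t.

DiffsInvariant : ℕ → ℕ → ℕ → List ℕ → ℕ → Set
DiffsInvariant θ t x r x' = diffsFrom x' (stretchFrom θ t x r) ↭ diffsFrom x r ++ map (λ _ → t) (crossingsFrom θ x r)

stretchFrom-diffs : ∀ θ t x r → DiffsInvariant θ t x r (lift θ t x)
stretchFrom-diffs θ t x [] = ↭-refl
stretchFrom-diffs θ t x (y ∷ r) with x <ᵇ θ | y <ᵇ θ in y<ᵇθ
... | _ | _ with subst (DiffsInvariant θ t y r) (lift-by θ t y y<ᵇθ) (stretchFrom-diffs θ t y r)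
stretchFrom-diffs θ t x (y ∷ r) | true  | true  | ih = prep ∣ x - y ∣ ih
stretchFrom-diffs θ t x (y ∷ r) | true  | false | ih rewrite ∣m-m+n∣≡n y t =
  prep ∣ x - y ∣ (↭-trans (prep t ih) (↭-sym (shift t (diffsFrom y r) _)))
stretchFrom-diffs θ t x (y ∷ r) | false | true  | ih rewrite ∣-∣-comm (x + t) x | ∣m-m+n∣≡n x t =
  ↭-trans (swap t ∣ x - y ∣ ↭-refl) (prep ∣ x - y ∣ (↭-trans (prep t ih) (↭-sym (shift t (diffsFrom y r) _))))
stretchFrom-diffs θ t x (y ∷ r) | false | false | ih rewrite ∣-∣-translate x y t = prep ∣ x - y ∣ ih

stretch-diffs : ∀ θ t P → diffs (stretch θ t P) ↭ diffs P ++ replicate (length (crossings θ P)) t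
stretch-diffs θ t [] = ↭-refl
stretch-diffs θ t (x ∷ r) =
  ↭-trans (stretchFrom-diffs θ t x r) (↭-reflexive (cong (diffsFrom x r ++_) (map-const (crossingsFrom θ x r))))
  where
  map-const : ∀ (xs : List ℕ) → map (λ _ → t) xs ≡ replicate (length xs) t
  map-const [] = refl
  map-const (_ ∷ xs) = cong (t ∷_) (map-const xs)

above-lower : ∀ {θ' θ z} → θ' ≤ θ → (z <ᵇ θ) ≡ false → θ' ≤ z
above-lower θ'≤θ z≮ᵇθ = ≤-trans θ'≤θ (not-below⇒above z≮ᵇθ)

lifted-above-lower : ∀ {θ' θ z} t → θ' ≤ θ → (z <ᵇ θ) ≡ false → θ' ≤ z + t
lifted-above-lower {z = z} t θ'≤θ z≮ᵇθ = ≤-trans (above-lower θ'≤θ z≮ᵇθ) (m≤m+n z t)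

-- Invariant 3: crossings of a lower threshold θ' ≤ θ are not affected by stretching
-- at θ, since every vertex that is moved or inserted lies above θ'.

CrossingsInvariant : ℕ → ℕ → ℕ → ℕ → List ℕ → ℕ → Set
CrossingsInvariant θ' θ t x r x' = crossingsFrom θ' x' (stretchFrom θ t x r) ≡ crossingsFrom θ' x r

stretchFrom-crossings : ∀ θ' θ t x r → θ' ≤ θ → CrossingsInvariant θ' θ t x r (lift θ t x)
stretchFrom-crossings θ' θ t x [] θ'≤θ = refl
stretchFrom-crossings θ' θ t x (y ∷ r) θ'≤θ with x <ᵇ θ in x<ᵇθ | y <ᵇ θ in y<ᵇθ
... | _ | _ with subst (CrossingsInvariant θ' θ t y r) (lift-by θ t y y<ᵇθ) (stretchFrom-crossings θ' θ t y r θ'≤θ)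
stretchFrom-crossings θ' θ t x (y ∷ r) θ'≤θ | true  | true  | ih = cong (crossing θ' x y ++_) ih
stretchFrom-crossings θ' θ t x (y ∷ r) θ'≤θ | true  | false | ih
  rewrite crossing-above (above-lower θ'≤θ y<ᵇθ) (lifted-above-lower t θ'≤θ y<ᵇθ) = cong (crossing θ' x y ++_) ih
stretchFrom-crossings θ' θ t x (y ∷ r) θ'≤θ | false | true  | ih
  rewrite crossing-above (lifted-above-lower t θ'≤θ x<ᵇθ) (above-lower θ'≤θ x<ᵇθ) = cong (crossing θ' x y ++_) ih
stretchFrom-crossings θ' θ t x (y ∷ r) θ'≤θ | false | false | ih
  rewrite crossing-above (lifted-above-lower t θ'≤θ x<ᵇθ) (lifted-above-lower t θ'≤θ y<ᵇθ)
        | crossing-above (above-lower θ'≤θ x<ᵇθ) (above-lower θ'≤θ y<ᵇθ) = ih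

stretch-crossings : ∀ θ' θ t P → θ' ≤ θ → crossings θ' (stretch θ t P) ≡ crossings θ' P
stretch-crossings θ' θ t [] θ'≤θ = refl
stretch-crossings θ' θ t (x ∷ r) θ'≤θ = stretchFrom-crossings θ' θ t x r θ'≤θ

lift-below : ∀ θ t x → x < θ → lift θ t x ≡ x
lift-below θ t x x<θ = lift-by θ t x (Equivalence.to T-≡ (<⇒<ᵇ x<θ))

lift-above : ∀ θ t x → θ ≤ x → lift θ t x ≡ x + t
lift-above θ t x θ≤x = lift-by θ t x (above⇒not-below θ≤x)

map-lift-below : ∀ θ t s n → s + n ≤ θ → map (lift θ t) (interval s n) ≡ interval s n
map-lift-below θ t s zero _ = refl
map-lift-below θ t s (suc n) s+n<θ =
  cong₂ _∷_ (lift-below θ t s (≤-trans (s≤s (m≤m+n s n)) s+n<θ')) (map-lift-below θ t (suc s) n s+n<θ')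
  where s+n<θ' = subst (_≤ θ) (+-suc s n) s+n<θ

map-lift-above : ∀ θ t s n → θ ≤ s → map (lift θ t) (interval s n) ≡ interval (s + t) n
map-lift-above θ t s zero _ = refl
map-lift-above θ t s (suc n) θ≤s =
  cong₂ _∷_ (lift-above θ t s θ≤s) (map-lift-above θ t (suc s) n (m≤n⇒m≤1+n θ≤s))

lift-upTo : ∀ θ t m → map (lift θ t) (upTo (θ + m)) ++ interval θ t ↭ upTo (θ + m + t)
lift-upTo θ t m = begin
  map (lift θ t) (upTo (θ + m)) ++ interval θ t
    ≡⟨ cong (λ xs → map (lift θ t) xs ++ interval θ t) (trans (upTo≡interval (θ + m)) (sym (interval-++ 0 θ m))) ⟩
  map (lift θ t) (interval 0 θ ++ interval θ m) ++ interval θ t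
    ≡⟨ cong (_++ interval θ t) (trans (map-++ (lift θ t) (interval 0 θ) (interval θ m))
         (cong₂ _++_ (map-lift-below θ t 0 θ ≤-refl) (map-lift-above θ t θ m ≤-refl))) ⟩
  (interval 0 θ ++ interval (θ + t) m) ++ interval θ t
    ≡⟨ ++-assoc (interval 0 θ) (interval (θ + t) m) (interval θ t) ⟩
  interval 0 θ ++ interval (θ + t) m ++ interval θ t
    ↭⟨ ++⁺ˡ (interval 0 θ) (++-comm (interval (θ + t) m) (interval θ t)) ⟩
  interval 0 θ ++ interval θ t ++ interval (θ + t) m
    ≡⟨ trans (cong (interval 0 θ ++_) (interval-++ θ t m)) (interval-++ 0 θ (t + m)) ⟩
  interval 0 (θ + (t + m))
    ≡⟨ cong (interval 0) (trans (cong (θ +_) (+-comm t m)) (sym (+-assoc θ m t))) ⟩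
  interval 0 (θ + m + t)
    ≡⟨ sym (upTo≡interval (θ + m + t)) ⟩
  upTo (θ + m + t) ∎
  where open PermutationReasoning

stretch-hamiltonian : ∀ θ t v P → P ↭ upTo v → θ ≤ v → crossings θ P ↭ interval θ t →
  stretch θ t P ↭ upTo (v + t)
stretch-hamiltonian θ t v P P↭ θ≤v cross = begin
  stretch θ t P                                ↭⟨ stretch-vertices θ t P ⟩
  map (lift θ t) P ++ crossings θ P            ↭⟨ ++⁺ (map⁺ (lift θ t) P↭) cross ⟩
  map (lift θ t) (upTo v) ++ interval θ t      ≡⟨ cong (λ w → map (lift θ t) (upTo w) ++ interval θ t) (sym v≡) ⟩
  map (lift θ t) (upTo (θ + (v ∸ θ))) ++ interval θ t ↭⟨ lift-upTo θ t (v ∸ θ) ⟩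
  upTo (θ + (v ∸ θ) + t)                       ≡⟨ cong (λ w → upTo (w + t)) v≡ ⟩
  upTo (v + t)                                 ∎
  where
  open PermutationReasoning
  v≡ : θ + (v ∸ θ) ≡ v
  v≡ = m+[n∸m]≡n θ≤v

-- Repeated stretching at the same threshold.  By invariant 3 the crossings at θ
-- stay the same, so each round again adds t vertices and t copies of t.

stretchⁿ : ℕ → ℕ → ℕ → List ℕ → List ℕ
stretchⁿ θ t zero P = P
stretchⁿ θ t (suc k) P = stretch θ t (stretchⁿ θ t k P)

stretchⁿ-crossings : ∀ θ' θ t k P → θ' ≤ θ → crossings θ' (stretchⁿ θ t k P) ≡ crossings θ' P
stretchⁿ-crossings θ' θ t zero P θ'≤θ = refl
stretchⁿ-crossings θ' θ t (suc k) P θ'≤θ =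
  trans (stretch-crossings θ' θ t (stretchⁿ θ t k P) θ'≤θ) (stretchⁿ-crossings θ' θ t k P θ'≤θ)

stretchⁿ-hamiltonian : ∀ θ t k v P → P ↭ upTo v → θ ≤ v → crossings θ P ↭ interval θ t →
  stretchⁿ θ t k P ↭ upTo (v + k * t)
stretchⁿ-hamiltonian θ t zero v P P↭ θ≤v cross rewrite +-identityʳ v = P↭
stretchⁿ-hamiltonian θ t (suc k) v P P↭ θ≤v cross =
  subst (λ w → stretchⁿ θ t (suc k) P ↭ upTo w) (trans (+-assoc v (k * t) t) (cong (v +_) (+-comm (k * t) t)))
    (stretch-hamiltonian θ t (v + k * t) (stretchⁿ θ t k P)
      (stretchⁿ-hamiltonian θ t k v P P↭ θ≤v cross) (≤-trans θ≤v (m≤m+n v (k * t)))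
      (subst (_↭ interval θ t) (sym (stretchⁿ-crossings θ θ t k P ≤-refl)) cross))

stretchⁿ-diffs : ∀ θ t k P → crossings θ P ↭ interval θ t →
  diffs (stretchⁿ θ t k P) ↭ diffs P ++ replicate (k * t) t
stretchⁿ-diffs θ t zero P cross = ↭-reflexive (sym (++-identityʳ (diffs P)))
stretchⁿ-diffs θ t (suc k) P cross = begin
  diffs (stretch θ t Q)                                    ↭⟨ stretch-diffs θ t Q ⟩
  diffs Q ++ replicate (length (crossings θ Q)) t          ≡⟨ cong (λ n → diffs Q ++ replicate n t) crossings-count ⟩
  diffs Q ++ replicate t t                                 ↭⟨ ++⁺ʳ (replicate t t) (stretchⁿ-diffs θ t k P cross) ⟩
  (diffs P ++ replicate (k * t) t) ++ replicate t t        ≡⟨ ++-assoc (diffs P) _ _ ⟩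
  diffs P ++ replicate (k * t) t ++ replicate t t          ↭⟨ ++⁺ˡ (diffs P) (++-comm (replicate (k * t) t) _) ⟩
  diffs P ++ replicate t t ++ replicate (k * t) t          ≡⟨ cong (diffs P ++_) (replicate-++ t (k * t) t) ⟩
  diffs P ++ replicate (t + k * t) t                       ∎
  where
  open PermutationReasoning
  Q = stretchⁿ θ t k P
  crossings-count : length (crossings θ Q) ≡ t
  crossings-count = trans (cong length (stretchⁿ-crossings θ θ t k P ≤-refl))
                          (trans (↭-length cross) (length-interval θ t))

-- A program is applicable to a path P on v vertices when every step
-- has the right crossings in P, a threshold at most v, and the thresholds never increase
-- (so that by invariant 3 later steps still see the crossings of P).

data Len : Set where
  one two three four : Len

len : Len → ℕ
len one = 1
len two = 2
len three = 3
len four = 4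

record Step : Set where
  constructor step
  field
    threshold : ℕ
    size      : Len
    times     : ℕ

open Step using (threshold)

run : List Step → List ℕ → List ℕ
run [] P = P
run (step θ l k ∷ ss) P = run ss (stretchⁿ θ (len l) k P)

verticesAfter : ℕ → List Step → ℕ
verticesAfter v [] = v
verticesAfter v (step θ l k ∷ ss) = verticesAfter (v + k * len l) ss

added : List Step → List ℕ
added [] = []
added (step θ l k ∷ ss) = replicate (k * len l) (len l) ++ added ss

Applicable : List ℕ → ℕ → List Step → Set
Applicable P v [] = ⊤
Applicable P v (step θ l k ∷ ss) =
  (crossings θ P ↭ interval θ (len l)) × θ ≤ v × All (λ s → threshold s ≤ θ) ss × Applicable P v ss

applicable-stretchⁿ : ∀ θ l k P v ss → All (λ s → threshold s ≤ θ) ss → Applicable P v ss →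
  Applicable (stretchⁿ θ (len l) k P) (v + k * len l) ss
applicable-stretchⁿ θ l k P v [] _ _ = tt
applicable-stretchⁿ θ l k P v (step θ₁ l₁ k₁ ∷ ss) (θ₁≤θ ∷ below) (cross , θ₁≤v , below₁ , rest) =
  subst (_↭ interval θ₁ (len l₁)) (sym (stretchⁿ-crossings θ₁ θ (len l) k P θ₁≤θ)) cross ,
  ≤-trans θ₁≤v (m≤m+n v _) , below₁ , applicable-stretchⁿ θ l k P v ss below rest

run-hamiltonian : ∀ ss P v → Applicable P v ss → P ↭ upTo v → run ss P ↭ upTo (verticesAfter v ss)
run-hamiltonian [] P v _ P↭ = P↭
run-hamiltonian (step θ l k ∷ ss) P v (cross , θ≤v , below , rest) P↭ =
  run-hamiltonian ss (stretchⁿ θ (len l) k P) (v + k * len l)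
    (applicable-stretchⁿ θ l k P v ss below rest) (stretchⁿ-hamiltonian θ (len l) k v P P↭ θ≤v cross)

run-diffs : ∀ ss P v → Applicable P v ss → diffs (run ss P) ↭ diffs P ++ added ss
run-diffs [] P v _ = ↭-reflexive (sym (++-identityʳ (diffs P)))
run-diffs (step θ l k ∷ ss) P v (cross , _ , below , rest) = begin
  diffs (run ss Q)                                           ↭⟨ run-diffs ss Q _ (applicable-stretchⁿ θ l k P v ss below rest) ⟩
  diffs Q ++ added ss                                        ↭⟨ ++⁺ʳ (added ss) (stretchⁿ-diffs θ (len l) k P cross) ⟩
  (diffs P ++ replicate (k * len l) (len l)) ++ added ss     ≡⟨ ++-assoc (diffs P) _ (added ss) ⟩
  diffs P ++ replicate (k * len l) (len l) ++ added ss       ∎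
  where
  open PermutationReasoning
  Q = stretchⁿ θ (len l) k P

allBelowᵇ : ℕ → List Step → Bool
allBelowᵇ θ [] = true
allBelowᵇ θ (s ∷ ss) = (threshold s ≤ᵇ θ) ∧ allBelowᵇ θ ss

allBelowᵇ-sound : ∀ θ ss → T (allBelowᵇ θ ss) → All (λ s → threshold s ≤ θ) ss
allBelowᵇ-sound θ [] _ = []
allBelowᵇ-sound θ (s ∷ ss) h =
  ≤ᵇ⇒≤ (threshold s) θ (proj₁ (Equivalence.to T-∧ h)) ∷ allBelowᵇ-sound θ ss (proj₂ (Equivalence.to T-∧ h))

applicableᵇ : List ℕ → ℕ → List Step → Bool
applicableᵇ P v [] = true
applicableᵇ P v (step θ l k ∷ ss) =
  permᵇ (crossings θ P) (interval θ (len l)) ∧ (θ ≤ᵇ v) ∧ allBelowᵇ θ ss ∧ applicableᵇ P v ss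

applicableᵇ-sound : ∀ P v ss → T (applicableᵇ P v ss) → Applicable P v ss
applicableᵇ-sound P v [] _ = tt
applicableᵇ-sound P v (step θ l k ∷ ss) h
  with (h₁ , h′) ← Equivalence.to T-∧ h
  with (h₂ , h″) ← Equivalence.to T-∧ h′
  with (h₃ , h₄) ← Equivalence.to T-∧ h″ =
  permᵇ-sound _ _ h₁ , ≤ᵇ⇒≤ θ v h₂ , allBelowᵇ-sound θ ss h₃ , applicableᵇ-sound P v ss h₄

record Counts : Set where
  constructor counts
  field a b c d : ℕ

lengths : Counts → List ℕ
lengths (counts a b c d) = L1234 a b c d

order : Counts → ℕ
order (counts a b c d) = a + b + c + d + 1

extend : Len → ℕ → Counts → Counts
extend one   n (counts a b c d) = counts (a + n) b c d
extend two   n (counts a b c d) = counts a (b + n) c d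
extend three n (counts a b c d) = counts a b (c + n) d
extend four  n (counts a b c d) = counts a b c (d + n)

extendAll : Counts → List Step → Counts
extendAll C [] = C
extendAll C (step θ l k ∷ ss) = extendAll (extend l (k * len l) C) ss

absorb : ∀ m n (x : ℕ) ys → (replicate m x ++ ys) ++ replicate n x ↭ replicate (m + n) x ++ ys
absorb m n x ys = begin
  (replicate m x ++ ys) ++ replicate n x   ≡⟨ ++-assoc (replicate m x) ys _ ⟩
  replicate m x ++ ys ++ replicate n x     ↭⟨ ++⁺ˡ (replicate m x) (++-comm ys (replicate n x)) ⟩
  replicate m x ++ replicate n x ++ ys     ≡⟨ sym (++-assoc (replicate m x) _ ys) ⟩
  (replicate m x ++ replicate n x) ++ ys   ≡⟨ cong (_++ ys) (replicate-++ m n x) ⟩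
  replicate (m + n) x ++ ys                ∎
  where open PermutationReasoning

pass : ∀ (xs : List ℕ) {ys zs} ws → ys ++ ws ↭ zs → (xs ++ ys) ++ ws ↭ xs ++ zs
pass xs {ys} ws p = ↭-trans (↭-reflexive (++-assoc xs ys ws)) (++⁺ˡ xs p)

extend-lengths : ∀ l n C → lengths C ++ replicate n (len l) ↭ lengths (extend l n C)
extend-lengths one   n (counts a b c d) = absorb a n 1 _
extend-lengths two   n (counts a b c d) = pass (replicate a 1) _ (absorb b n 2 _)
extend-lengths three n (counts a b c d) =
  pass (replicate a 1) _ (pass (replicate b 2) _ (absorb c n 3 (replicate d 4)))
extend-lengths four  n (counts a b c d) =
  pass (replicate a 1) _ (pass (replicate b 2) _ (pass (replicate c 3) _ (↭-reflexive (replicate-++ d n 4))))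

open +-*-Solver using (solve; _:+_; _:=_; con)

extend-order : ∀ l n C → order C + n ≡ order (extend l n C)
extend-order one   n (counts a b c d) =
  solve 5 (λ a b c d n → a :+ b :+ c :+ d :+ con 1 :+ n := (a :+ n) :+ b :+ c :+ d :+ con 1) refl a b c d n
extend-order two   n (counts a b c d) =
  solve 5 (λ a b c d n → a :+ b :+ c :+ d :+ con 1 :+ n := a :+ (b :+ n) :+ c :+ d :+ con 1) refl a b c d n
extend-order three n (counts a b c d) =
  solve 5 (λ a b c d n → a :+ b :+ c :+ d :+ con 1 :+ n := a :+ b :+ (c :+ n) :+ d :+ con 1) refl a b c d n
extend-order four  n (counts a b c d) =
  solve 5 (λ a b c d n → a :+ b :+ c :+ d :+ con 1 :+ n := a :+ b :+ c :+ (d :+ n) :+ con 1) refl a b c d n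

extendAll-lengths : ∀ C ss → lengths C ++ added ss ↭ lengths (extendAll C ss)
extendAll-lengths C [] = ↭-reflexive (++-identityʳ (lengths C))
extendAll-lengths C (step θ l k ∷ ss) = begin
  lengths C ++ replicate (k * len l) (len l) ++ added ss     ≡⟨ sym (++-assoc (lengths C) _ (added ss)) ⟩
  (lengths C ++ replicate (k * len l) (len l)) ++ added ss   ↭⟨ ++⁺ʳ (added ss) (extend-lengths l (k * len l) C) ⟩
  lengths (extend l (k * len l) C) ++ added ss               ↭⟨ extendAll-lengths (extend l (k * len l) C) ss ⟩
  lengths (extendAll C (step θ l k ∷ ss))                    ∎
  where open PermutationReasoning

extendAll-order : ∀ C ss → verticesAfter (order C) ss ≡ order (extendAll C ss)
extendAll-order C [] = refl
extendAll-order C (step θ l k ∷ ss) =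
  trans (cong (λ v → verticesAfter v ss) (extend-order l (k * len l) C)) (extendAll-order (extend l (k * len l) C) ss)

LinearRealization : Counts → Set
LinearRealization C = Σ (List ℕ) (λ H → H ↭ upTo (order C) × diffs H ↭ lengths C)

realize : ∀ C P ss → T (permᵇ P (upTo (order C))) → T (permᵇ (diffs P) (lengths C)) →
  T (applicableᵇ P (order C) ss) → LinearRealization (extendAll C ss)
realize C P ss hamᵇ diffsᵇ applicableᵇ-ok =
  run ss P ,
  subst (λ v → run ss P ↭ upTo v) (extendAll-order C ss) (run-hamiltonian ss P (order C) ok (permᵇ-sound _ _ hamᵇ)) ,
  ↭-trans (run-diffs ss P (order C) ok) (↭-trans (++⁺ʳ (added ss) (permᵇ-sound _ _ diffsᵇ)) (extendAll-lengths C ss))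
  where
  ok : Applicable P (order C) ss
  ok = applicableᵇ-sound P (order C) ss applicableᵇ-ok

-- Residue views: every admissible parameter is a base value plus a multiple of the
-- block size used to extend it (1, 2, 3, 4 copies of lengths 1, 2, 3, 4).  The
-- indices are written exactly as extendAll computes them (hence k * 1 for a).

data ViewA : ℕ → Set where
  a2 : ViewA 2
  a3 : ∀ k → ViewA (3 + k * 1)

viewA : ∀ a b → (3 ≤ a ⊎ (a ≡ 2 × 1 ≤ b)) → ViewA a
viewA a b (inj₂ (refl , _)) = a2
viewA (suc (suc (suc k))) b (inj₁ _) = subst ViewA (cong (3 +_) (*-identityʳ k)) (a3 k)
viewA 1 b (inj₁ (s≤s ()))
viewA 2 b (inj₁ (s≤s (s≤s ())))

data ViewB : ℕ → Set where
  b0 : ViewB 0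
  b1 : ∀ k → ViewB (1 + k * 2)
  b2 : ∀ k → ViewB (2 + k * 2)

viewB : ∀ b → ViewB b
viewB 0 = b0
viewB 1 = b1 0
viewB (suc (suc b)) with viewB b
... | b0 = b2 0
... | b1 k = b1 (suc k)
... | b2 k = b2 (suc k)

data ViewC : ℕ → Set where
  c1 : ViewC 1
  c2 : ∀ k → ViewC (2 + k * 3)
  c3 : ∀ k → ViewC (3 + k * 3)
  c4 : ∀ k → ViewC (4 + k * 3)

viewC : ∀ c → 1 ≤ c → ViewC c
viewC 1 _ = c1
viewC 2 _ = c2 0
viewC 3 _ = c3 0
viewC (suc (suc (suc (suc c)))) _ with viewC (suc c) (s≤s z≤n)
... | c1 = c4 0
... | c2 k = c2 (suc k)
... | c3 k = c3 (suc k)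
... | c4 k = c4 (suc k)

data ViewD : ℕ → Set where
  d1 : ViewD 1
  d2 : ∀ k → ViewD (2 + k * 4)
  d3 : ∀ k → ViewD (3 + k * 4)
  d4 : ∀ k → ViewD (4 + k * 4)
  d5 : ∀ k → ViewD (5 + k * 4)

viewD : ∀ d → 1 ≤ d → ViewD d
viewD 1 _ = d1
viewD 2 _ = d2 0
viewD 3 _ = d3 0
viewD 4 _ = d4 0
viewD (suc (suc (suc (suc (suc d))))) _ with viewD (suc d) (s≤s z≤n)
... | d1 = d5 0
... | d2 k = d2 (suc k)
... | d3 k = d3 (suc k)
... | d4 k = d4 (suc k)
... | d5 k = d5 (suc k)

not-2-0 : ¬ (3 ≤ 2 ⊎ (2 ≡ 2 × 1 ≤ 0))
not-2-0 (inj₁ (s≤s (s≤s ())))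
not-2-0 (inj₂ (_ , ()))

linear-realization : ∀ a b c d → 1 ≤ c → 1 ≤ d → (3 ≤ a ⊎ (a ≡ 2 × 1 ≤ b)) → LinearRealization (counts a b c d)
linear-realization a b c d c≥1 d≥1 cond with viewA a b cond | viewB b | viewC c c≥1 | viewD d d≥1
... | a2 | b0 | _ | _ = ⊥-elim (not-2-0 cond)
... | a2 | b1 k2 | c1 | d1 = realize (counts 2 1 1 1) (0 ∷ 3 ∷ 2 ∷ 4 ∷ 5 ∷ 1 ∷ []) (step 4 two k2 ∷ []) tt tt tt
... | a2 | b1 k2 | c1 | d2 k4 = realize (counts 2 1 1 2) (0 ∷ 3 ∷ 4 ∷ 2 ∷ 6 ∷ 5 ∷ 1 ∷ []) (step 5 two k2 ∷ step 3 four k4 ∷ []) tt tt tt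
... | a2 | b1 k2 | c1 | d3 k4 = realize (counts 2 1 1 3) (0 ∷ 3 ∷ 7 ∷ 6 ∷ 2 ∷ 4 ∷ 5 ∷ 1 ∷ []) (step 6 two k2 ∷ step 3 four k4 ∷ []) tt tt tt
... | a2 | b1 k2 | c1 | d4 k4 = realize (counts 2 1 1 4) (0 ∷ 2 ∷ 6 ∷ 5 ∷ 1 ∷ 4 ∷ 8 ∷ 7 ∷ 3 ∷ []) (step 7 two k2 ∷ step 4 four k4 ∷ []) tt tt tt
... | a2 | b1 k2 | c1 | d5 k4 = realize (counts 2 1 1 5) (0 ∷ 3 ∷ 7 ∷ 6 ∷ 2 ∷ 4 ∷ 8 ∷ 9 ∷ 5 ∷ 1 ∷ []) (step 8 two k2 ∷ step 3 four k4 ∷ []) tt tt tt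
... | a2 | b1 k2 | c2 k3 | d1 = realize (counts 2 1 2 1) (0 ∷ 2 ∷ 3 ∷ 6 ∷ 5 ∷ 1 ∷ 4 ∷ []) (step 5 two k2 ∷ step 3 three k3 ∷ []) tt tt tt
... | a2 | b1 k2 | c2 k3 | d2 k4 = realize (counts 2 1 2 2) (2 ∷ 1 ∷ 5 ∷ 7 ∷ 6 ∷ 3 ∷ 0 ∷ 4 ∷ []) (step 5 two k2 ∷ step 3 three k3 ∷ step 2 four k4 ∷ []) tt tt tt
... | a2 | b1 k2 | c2 k3 | d3 k4 = realize (counts 2 1 2 3) (2 ∷ 1 ∷ 5 ∷ 7 ∷ 8 ∷ 4 ∷ 0 ∷ 3 ∷ 6 ∷ []) (step 7 two k2 ∷ step 3 three k3 ∷ step 2 four k4 ∷ []) tt tt tt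
... | a2 | b1 k2 | c2 k3 | d4 k4 = realize (counts 2 1 2 4) (2 ∷ 1 ∷ 5 ∷ 7 ∷ 3 ∷ 0 ∷ 4 ∷ 8 ∷ 9 ∷ 6 ∷ []) (step 8 two k2 ∷ step 3 three k3 ∷ step 2 four k4 ∷ []) tt tt tt
... | a2 | b1 k2 | c2 k3 | d5 k4 = realize (counts 2 1 2 5) (1 ∷ 2 ∷ 6 ∷ 8 ∷ 4 ∷ 0 ∷ 3 ∷ 7 ∷ 10 ∷ 9 ∷ 5 ∷ []) (step 9 two k2 ∷ step 6 four k4 ∷ step 2 three k3 ∷ []) tt tt tt
... | a2 | b1 k2 | c3 k3 | d1 = realize (counts 2 1 3 1) (0 ∷ 2 ∷ 3 ∷ 6 ∷ 7 ∷ 4 ∷ 1 ∷ 5 ∷ []) (step 6 two k2 ∷ step 3 three k3 ∷ []) tt tt tt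
... | a2 | b1 k2 | c3 k3 | d2 k4 = realize (counts 2 1 3 2) (2 ∷ 1 ∷ 5 ∷ 8 ∷ 6 ∷ 7 ∷ 4 ∷ 0 ∷ 3 ∷ []) (step 4 two k2 ∷ step 3 three k3 ∷ step 2 four k4 ∷ []) tt tt tt
... | a2 | b1 k2 | c3 k3 | d3 k4 = realize (counts 2 1 3 3) (2 ∷ 1 ∷ 5 ∷ 8 ∷ 9 ∷ 6 ∷ 4 ∷ 0 ∷ 3 ∷ 7 ∷ []) (step 8 two k2 ∷ step 3 three k3 ∷ step 2 four k4 ∷ []) tt tt tt
... | a2 | b1 k2 | c3 k3 | d4 k4 = realize (counts 2 1 3 4) (1 ∷ 2 ∷ 6 ∷ 8 ∷ 5 ∷ 9 ∷ 10 ∷ 7 ∷ 3 ∷ 0 ∷ 4 ∷ []) (step 9 two k2 ∷ step 6 four k4 ∷ step 2 three k3 ∷ []) tt tt tt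
... | a2 | b1 k2 | c3 k3 | d5 k4 = realize (counts 2 1 3 5) (0 ∷ 3 ∷ 1 ∷ 4 ∷ 8 ∷ 9 ∷ 5 ∷ 2 ∷ 6 ∷ 10 ∷ 11 ∷ 7 ∷ []) (step 10 two k2 ∷ step 8 four k4 ∷ step 4 three k3 ∷ []) tt tt tt
... | a2 | b1 k2 | c4 k3 | d1 = realize (counts 2 1 4 1) (0 ∷ 1 ∷ 4 ∷ 2 ∷ 5 ∷ 8 ∷ 7 ∷ 3 ∷ 6 ∷ []) (step 7 two k2 ∷ step 5 three k3 ∷ []) tt tt tt
... | a2 | b1 k2 | c4 k3 | d2 k4 = realize (counts 2 1 4 2) (0 ∷ 3 ∷ 6 ∷ 9 ∷ 5 ∷ 7 ∷ 8 ∷ 4 ∷ 1 ∷ 2 ∷ []) (step 6 four k4 ∷ step 3 two k2 ∷ step 2 three k3 ∷ []) tt tt tt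
... | a2 | b1 k2 | c4 k3 | d3 k4 = realize (counts 2 1 4 3) (0 ∷ 3 ∷ 6 ∷ 10 ∷ 7 ∷ 5 ∷ 9 ∷ 8 ∷ 4 ∷ 1 ∷ 2 ∷ []) (step 6 four k4 ∷ step 3 two k2 ∷ step 2 three k3 ∷ []) tt tt tt
... | a2 | b1 k2 | c4 k3 | d4 k4 = realize (counts 2 1 4 4) (0 ∷ 3 ∷ 2 ∷ 6 ∷ 8 ∷ 11 ∷ 7 ∷ 10 ∷ 9 ∷ 5 ∷ 1 ∷ 4 ∷ []) (step 8 four k4 ∷ step 5 two k2 ∷ step 4 three k3 ∷ []) tt tt tt
... | a2 | b1 k2 | c4 k3 | d5 k4 = realize (counts 2 1 4 5) (0 ∷ 3 ∷ 2 ∷ 6 ∷ 10 ∷ 11 ∷ 7 ∷ 9 ∷ 12 ∷ 8 ∷ 5 ∷ 1 ∷ 4 ∷ []) (step 8 four k4 ∷ step 5 two k2 ∷ step 4 three k3 ∷ []) tt tt tt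
... | a2 | b2 k2 | c1 | d1 = realize (counts 2 2 1 1) (0 ∷ 1 ∷ 4 ∷ 2 ∷ 6 ∷ 5 ∷ 3 ∷ []) (step 5 two k2 ∷ []) tt tt tt
... | a2 | b2 k2 | c1 | d2 k4 = realize (counts 2 2 1 2) (0 ∷ 2 ∷ 6 ∷ 7 ∷ 3 ∷ 5 ∷ 4 ∷ 1 ∷ []) (step 6 two k2 ∷ step 4 four k4 ∷ []) tt tt tt
... | a2 | b2 k2 | c1 | d3 k4 = realize (counts 2 2 1 3) (0 ∷ 2 ∷ 4 ∷ 8 ∷ 7 ∷ 3 ∷ 6 ∷ 5 ∷ 1 ∷ []) (step 7 two k2 ∷ step 4 four k4 ∷ []) tt tt tt
... | a2 | b2 k2 | c1 | d4 k4 = realize (counts 2 2 1 4) (0 ∷ 1 ∷ 5 ∷ 9 ∷ 8 ∷ 6 ∷ 2 ∷ 4 ∷ 7 ∷ 3 ∷ []) (step 8 two k2 ∷ step 4 four k4 ∷ []) tt tt tt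
... | a2 | b2 k2 | c1 | d5 k4 = realize (counts 2 2 1 5) (0 ∷ 1 ∷ 5 ∷ 8 ∷ 4 ∷ 2 ∷ 6 ∷ 10 ∷ 9 ∷ 7 ∷ 3 ∷ []) (step 9 two k2 ∷ step 4 four k4 ∷ []) tt tt tt
... | a2 | b2 k2 | c2 k3 | d1 = realize (counts 2 2 2 1) (0 ∷ 2 ∷ 3 ∷ 6 ∷ 7 ∷ 5 ∷ 1 ∷ 4 ∷ []) (step 5 two k2 ∷ step 3 three k3 ∷ []) tt tt tt
... | a2 | b2 k2 | c2 k3 | d2 k4 = realize (counts 2 2 2 2) (2 ∷ 1 ∷ 5 ∷ 7 ∷ 8 ∷ 6 ∷ 3 ∷ 0 ∷ 4 ∷ []) (step 5 two k2 ∷ step 3 three k3 ∷ step 2 four k4 ∷ []) tt tt tt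
... | a2 | b2 k2 | c2 k3 | d3 k4 = realize (counts 2 2 2 3) (0 ∷ 3 ∷ 7 ∷ 9 ∷ 5 ∷ 6 ∷ 8 ∷ 4 ∷ 1 ∷ 2 ∷ []) (step 6 four k4 ∷ step 3 two k2 ∷ step 2 three k3 ∷ []) tt tt tt
... | a2 | b2 k2 | c2 k3 | d4 k4 = realize (counts 2 2 2 4) (0 ∷ 2 ∷ 6 ∷ 10 ∷ 9 ∷ 5 ∷ 8 ∷ 7 ∷ 3 ∷ 1 ∷ 4 ∷ []) (step 9 two k2 ∷ step 6 four k4 ∷ step 2 three k3 ∷ []) tt tt tt
... | a2 | b2 k2 | c2 k3 | d5 k4 = realize (counts 2 2 2 5) (0 ∷ 2 ∷ 3 ∷ 7 ∷ 9 ∷ 5 ∷ 1 ∷ 4 ∷ 8 ∷ 11 ∷ 10 ∷ 6 ∷ []) (step 10 two k2 ∷ step 7 four k4 ∷ step 3 three k3 ∷ []) tt tt tt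
... | a2 | b2 k2 | c3 k3 | d1 = realize (counts 2 2 3 1) (0 ∷ 2 ∷ 3 ∷ 6 ∷ 8 ∷ 7 ∷ 4 ∷ 1 ∷ 5 ∷ []) (step 6 two k2 ∷ step 3 three k3 ∷ []) tt tt tt
... | a2 | b2 k2 | c3 k3 | d2 k4 = realize (counts 2 2 3 2) (1 ∷ 4 ∷ 8 ∷ 9 ∷ 5 ∷ 7 ∷ 6 ∷ 3 ∷ 0 ∷ 2 ∷ []) (step 6 four k4 ∷ step 3 two k2 ∷ step 2 three k3 ∷ []) tt tt tt
... | a2 | b2 k2 | c3 k3 | d3 k4 = realize (counts 2 2 3 3) (0 ∷ 2 ∷ 6 ∷ 10 ∷ 9 ∷ 5 ∷ 8 ∷ 7 ∷ 4 ∷ 1 ∷ 3 ∷ []) (step 9 two k2 ∷ step 6 four k4 ∷ step 2 three k3 ∷ []) tt tt tt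
... | a2 | b2 k2 | c3 k3 | d4 k4 = realize (counts 2 2 3 4) (0 ∷ 2 ∷ 3 ∷ 7 ∷ 9 ∷ 6 ∷ 10 ∷ 11 ∷ 8 ∷ 4 ∷ 1 ∷ 5 ∷ []) (step 10 two k2 ∷ step 7 four k4 ∷ step 3 three k3 ∷ []) tt tt tt
... | a2 | b2 k2 | c3 k3 | d5 k4 = realize (counts 2 2 3 5) (0 ∷ 2 ∷ 3 ∷ 6 ∷ 10 ∷ 8 ∷ 4 ∷ 1 ∷ 5 ∷ 9 ∷ 12 ∷ 11 ∷ 7 ∷ []) (step 11 two k2 ∷ step 8 four k4 ∷ step 3 three k3 ∷ []) tt tt tt
... | a2 | b2 k2 | c4 k3 | d1 = realize (counts 2 2 4 1) (0 ∷ 1 ∷ 3 ∷ 7 ∷ 4 ∷ 2 ∷ 5 ∷ 8 ∷ 9 ∷ 6 ∷ []) (step 8 two k2 ∷ step 3 three k3 ∷ []) tt tt tt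
... | a2 | b2 k2 | c4 k3 | d2 k4 = realize (counts 2 2 4 2) (0 ∷ 3 ∷ 5 ∷ 7 ∷ 10 ∷ 6 ∷ 9 ∷ 8 ∷ 4 ∷ 1 ∷ 2 ∷ []) (step 7 four k4 ∷ step 3 two k2 ∷ step 2 three k3 ∷ []) tt tt tt
... | a2 | b2 k2 | c4 k3 | d3 k4 = realize (counts 2 2 4 3) (0 ∷ 2 ∷ 3 ∷ 6 ∷ 8 ∷ 11 ∷ 7 ∷ 10 ∷ 9 ∷ 5 ∷ 1 ∷ 4 ∷ []) (step 8 four k4 ∷ step 5 two k2 ∷ step 3 three k3 ∷ []) tt tt tt
... | a2 | b2 k2 | c4 k3 | d4 k4 = realize (counts 2 2 4 4) (0 ∷ 2 ∷ 3 ∷ 6 ∷ 10 ∷ 11 ∷ 7 ∷ 9 ∷ 12 ∷ 8 ∷ 5 ∷ 1 ∷ 4 ∷ []) (step 8 four k4 ∷ step 5 two k2 ∷ step 3 three k3 ∷ []) tt tt tt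
... | a2 | b2 k2 | c4 k3 | d5 k4 = realize (counts 2 2 4 5) (0 ∷ 1 ∷ 3 ∷ 7 ∷ 11 ∷ 8 ∷ 4 ∷ 2 ∷ 5 ∷ 9 ∷ 12 ∷ 13 ∷ 10 ∷ 6 ∷ []) (step 12 two k2 ∷ step 7 four k4 ∷ step 3 three k3 ∷ []) tt tt tt
... | a3 k1 | b0 | c1 | d1 = realize (counts 3 0 1 1) (0 ∷ 1 ∷ 5 ∷ 2 ∷ 3 ∷ 4 ∷ []) (step 1 one k1 ∷ []) tt tt tt
... | a3 k1 | b0 | c1 | d2 k4 = realize (counts 3 0 1 2) (4 ∷ 0 ∷ 3 ∷ 2 ∷ 1 ∷ 5 ∷ 6 ∷ []) (step 5 one k1 ∷ step 2 four k4 ∷ []) tt tt tt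
... | a3 k1 | b0 | c1 | d3 k4 = realize (counts 3 0 1 3) (3 ∷ 2 ∷ 6 ∷ 5 ∷ 1 ∷ 0 ∷ 4 ∷ 7 ∷ []) (step 7 one k1 ∷ step 3 four k4 ∷ []) tt tt tt
... | a3 k1 | b0 | c1 | d4 k4 = realize (counts 3 0 1 4) (0 ∷ 1 ∷ 5 ∷ 8 ∷ 4 ∷ 3 ∷ 7 ∷ 6 ∷ 2 ∷ []) (step 4 four k4 ∷ step 1 one k1 ∷ []) tt tt tt
... | a3 k1 | b0 | c1 | d5 k4 = realize (counts 3 0 1 5) (0 ∷ 1 ∷ 5 ∷ 9 ∷ 6 ∷ 2 ∷ 3 ∷ 7 ∷ 8 ∷ 4 ∷ []) (step 5 four k4 ∷ step 1 one k1 ∷ []) tt tt tt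
... | a3 k1 | b0 | c2 k3 | d1 = realize (counts 3 0 2 1) (1 ∷ 0 ∷ 3 ∷ 4 ∷ 5 ∷ 2 ∷ 6 ∷ []) (step 6 one k1 ∷ step 4 three k3 ∷ []) tt tt tt
... | a3 k1 | b0 | c2 k3 | d2 k4 = realize (counts 3 0 2 2) (2 ∷ 1 ∷ 5 ∷ 4 ∷ 0 ∷ 3 ∷ 6 ∷ 7 ∷ []) (step 6 one k1 ∷ step 3 three k3 ∷ step 2 four k4 ∷ []) tt tt tt
... | a3 k1 | b0 | c2 k3 | d3 k4 = realize (counts 3 0 2 3) (3 ∷ 2 ∷ 6 ∷ 7 ∷ 4 ∷ 0 ∷ 1 ∷ 5 ∷ 8 ∷ []) (step 8 one k1 ∷ step 4 three k3 ∷ step 3 four k4 ∷ []) tt tt tt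
... | a3 k1 | b0 | c2 k3 | d4 k4 = realize (counts 3 0 2 4) (4 ∷ 0 ∷ 1 ∷ 5 ∷ 8 ∷ 7 ∷ 3 ∷ 2 ∷ 6 ∷ 9 ∷ []) (step 9 one k1 ∷ step 5 three k3 ∷ step 3 four k4 ∷ []) tt tt tt
... | a3 k1 | b0 | c2 k3 | d5 k4 = realize (counts 3 0 2 5) (3 ∷ 2 ∷ 6 ∷ 9 ∷ 5 ∷ 1 ∷ 0 ∷ 4 ∷ 8 ∷ 7 ∷ 10 ∷ []) (step 10 one k1 ∷ step 4 three k3 ∷ step 3 four k4 ∷ []) tt tt tt
... | a3 k1 | b0 | c3 k3 | d1 = realize (counts 3 0 3 1) (0 ∷ 1 ∷ 4 ∷ 7 ∷ 3 ∷ 2 ∷ 5 ∷ 6 ∷ []) (step 3 three k3 ∷ step 1 one k1 ∷ []) tt tt tt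
... | a3 k1 | b0 | c3 k3 | d2 k4 = realize (counts 3 0 3 2) (2 ∷ 1 ∷ 5 ∷ 6 ∷ 3 ∷ 0 ∷ 4 ∷ 7 ∷ 8 ∷ []) (step 7 one k1 ∷ step 3 three k3 ∷ step 2 four k4 ∷ []) tt tt tt
... | a3 k1 | b0 | c3 k3 | d3 k4 = realize (counts 3 0 3 3) (3 ∷ 0 ∷ 1 ∷ 4 ∷ 8 ∷ 7 ∷ 6 ∷ 2 ∷ 5 ∷ 9 ∷ []) (step 9 one k1 ∷ step 4 three k3 ∷ step 3 four k4 ∷ []) tt tt tt
... | a3 k1 | b0 | c3 k3 | d4 k4 = realize (counts 3 0 3 4) (0 ∷ 1 ∷ 4 ∷ 8 ∷ 9 ∷ 5 ∷ 2 ∷ 3 ∷ 7 ∷ 10 ∷ 6 ∷ []) (step 7 four k4 ∷ step 3 three k3 ∷ step 1 one k1 ∷ []) tt tt tt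
... | a3 k1 | b0 | c3 k3 | d5 k4 = realize (counts 3 0 3 5) (0 ∷ 1 ∷ 4 ∷ 8 ∷ 11 ∷ 7 ∷ 3 ∷ 2 ∷ 5 ∷ 9 ∷ 10 ∷ 6 ∷ []) (step 7 four k4 ∷ step 3 three k3 ∷ step 1 one k1 ∷ []) tt tt tt
... | a3 k1 | b0 | c4 k3 | d1 = realize (counts 3 0 4 1) (0 ∷ 1 ∷ 4 ∷ 8 ∷ 5 ∷ 2 ∷ 3 ∷ 6 ∷ 7 ∷ []) (step 3 three k3 ∷ step 1 one k1 ∷ []) tt tt tt
... | a3 k1 | b0 | c4 k3 | d2 k4 = realize (counts 3 0 4 2) (4 ∷ 1 ∷ 0 ∷ 3 ∷ 7 ∷ 6 ∷ 2 ∷ 5 ∷ 8 ∷ 9 ∷ []) (step 8 one k1 ∷ step 5 three k3 ∷ step 3 four k4 ∷ []) tt tt tt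
... | a3 k1 | b0 | c4 k3 | d3 k4 = realize (counts 3 0 4 3) (0 ∷ 1 ∷ 4 ∷ 8 ∷ 9 ∷ 6 ∷ 10 ∷ 7 ∷ 3 ∷ 2 ∷ 5 ∷ []) (step 7 four k4 ∷ step 3 three k3 ∷ step 1 one k1 ∷ []) tt tt tt
... | a3 k1 | b0 | c4 k3 | d4 k4 = realize (counts 3 0 4 4) (1 ∷ 2 ∷ 3 ∷ 0 ∷ 4 ∷ 7 ∷ 11 ∷ 8 ∷ 5 ∷ 9 ∷ 10 ∷ 6 ∷ []) (step 7 four k4 ∷ step 4 one k1 ∷ step 2 three k3 ∷ []) tt tt tt
... | a3 k1 | b0 | c4 k3 | d5 k4 = realize (counts 3 0 4 5) (0 ∷ 1 ∷ 4 ∷ 8 ∷ 12 ∷ 9 ∷ 6 ∷ 10 ∷ 11 ∷ 7 ∷ 3 ∷ 2 ∷ 5 ∷ []) (step 7 four k4 ∷ step 3 three k3 ∷ step 1 one k1 ∷ []) tt tt tt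
... | a3 k1 | b1 k2 | c1 | d1 = realize (counts 3 1 1 1) (0 ∷ 1 ∷ 4 ∷ 3 ∷ 5 ∷ 6 ∷ 2 ∷ []) (step 5 two k2 ∷ step 1 one k1 ∷ []) tt tt tt
... | a3 k1 | b1 k2 | c1 | d2 k4 = realize (counts 3 1 1 2) (0 ∷ 1 ∷ 4 ∷ 5 ∷ 3 ∷ 7 ∷ 6 ∷ 2 ∷ []) (step 6 two k2 ∷ step 4 four k4 ∷ step 1 one k1 ∷ []) tt tt tt
... | a3 k1 | b1 k2 | c1 | d3 k4 = realize (counts 3 1 1 3) (0 ∷ 1 ∷ 4 ∷ 8 ∷ 7 ∷ 3 ∷ 5 ∷ 6 ∷ 2 ∷ []) (step 7 two k2 ∷ step 4 four k4 ∷ step 1 one k1 ∷ []) tt tt tt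
... | a3 k1 | b1 k2 | c1 | d4 k4 = realize (counts 3 1 1 4) (0 ∷ 1 ∷ 3 ∷ 7 ∷ 6 ∷ 2 ∷ 5 ∷ 9 ∷ 8 ∷ 4 ∷ []) (step 8 two k2 ∷ step 5 four k4 ∷ step 1 one k1 ∷ []) tt tt tt
... | a3 k1 | b1 k2 | c1 | d5 k4 = realize (counts 3 1 1 5) (0 ∷ 1 ∷ 4 ∷ 8 ∷ 7 ∷ 3 ∷ 5 ∷ 9 ∷ 10 ∷ 6 ∷ 2 ∷ []) (step 9 two k2 ∷ step 4 four k4 ∷ step 1 one k1 ∷ []) tt tt tt
... | a3 k1 | b1 k2 | c2 k3 | d1 = realize (counts 3 1 2 1) (0 ∷ 1 ∷ 3 ∷ 4 ∷ 7 ∷ 6 ∷ 2 ∷ 5 ∷ []) (step 6 two k2 ∷ step 4 three k3 ∷ step 1 one k1 ∷ []) tt tt tt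
... | a3 k1 | b1 k2 | c2 k3 | d2 k4 = realize (counts 3 1 2 2) (5 ∷ 3 ∷ 0 ∷ 1 ∷ 2 ∷ 6 ∷ 7 ∷ 4 ∷ 8 ∷ []) (step 8 one k1 ∷ step 6 three k3 ∷ step 5 four k4 ∷ step 2 two k2 ∷ []) tt tt tt
... | a3 k1 | b1 k2 | c2 k3 | d3 k4 = realize (counts 3 1 2 3) (4 ∷ 3 ∷ 7 ∷ 8 ∷ 5 ∷ 1 ∷ 0 ∷ 2 ∷ 6 ∷ 9 ∷ []) (step 9 one k1 ∷ step 5 three k3 ∷ step 4 four k4 ∷ step 1 two k2 ∷ []) tt tt tt
... | a3 k1 | b1 k2 | c2 k3 | d4 k4 = realize (counts 3 1 2 4) (5 ∷ 1 ∷ 0 ∷ 2 ∷ 6 ∷ 9 ∷ 8 ∷ 4 ∷ 3 ∷ 7 ∷ 10 ∷ []) (step 10 one k1 ∷ step 6 three k3 ∷ step 4 four k4 ∷ step 1 two k2 ∷ []) tt tt tt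
... | a3 k1 | b1 k2 | c2 k3 | d5 k4 = realize (counts 3 1 2 5) (4 ∷ 3 ∷ 7 ∷ 10 ∷ 6 ∷ 2 ∷ 0 ∷ 1 ∷ 5 ∷ 9 ∷ 8 ∷ 11 ∷ []) (step 11 one k1 ∷ step 5 three k3 ∷ step 4 four k4 ∷ step 1 two k2 ∷ []) tt tt tt
... | a3 k1 | b1 k2 | c3 k3 | d1 = realize (counts 3 1 3 1) (0 ∷ 1 ∷ 3 ∷ 4 ∷ 7 ∷ 8 ∷ 5 ∷ 2 ∷ 6 ∷ []) (step 7 two k2 ∷ step 4 three k3 ∷ step 1 one k1 ∷ []) tt tt tt
... | a3 k1 | b1 k2 | c3 k3 | d2 k4 = realize (counts 3 1 3 2) (3 ∷ 0 ∷ 4 ∷ 2 ∷ 1 ∷ 5 ∷ 8 ∷ 9 ∷ 6 ∷ 7 ∷ []) (step 8 two k2 ∷ step 7 three k3 ∷ step 5 one k1 ∷ step 2 four k4 ∷ []) tt tt tt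
... | a3 k1 | b1 k2 | c3 k3 | d3 k4 = realize (counts 3 1 3 3) (4 ∷ 1 ∷ 0 ∷ 2 ∷ 5 ∷ 9 ∷ 8 ∷ 7 ∷ 3 ∷ 6 ∷ 10 ∷ []) (step 10 one k1 ∷ step 5 three k3 ∷ step 4 four k4 ∷ step 1 two k2 ∷ []) tt tt tt
... | a3 k1 | b1 k2 | c3 k3 | d4 k4 = realize (counts 3 1 3 4) (1 ∷ 0 ∷ 2 ∷ 5 ∷ 9 ∷ 10 ∷ 6 ∷ 3 ∷ 4 ∷ 8 ∷ 11 ∷ 7 ∷ []) (step 8 four k4 ∷ step 4 three k3 ∷ step 2 one k1 ∷ step 1 two k2 ∷ []) tt tt tt
... | a3 k1 | b1 k2 | c3 k3 | d5 k4 = realize (counts 3 1 3 5) (0 ∷ 1 ∷ 4 ∷ 2 ∷ 5 ∷ 9 ∷ 10 ∷ 6 ∷ 3 ∷ 7 ∷ 11 ∷ 12 ∷ 8 ∷ []) (step 11 two k2 ∷ step 9 four k4 ∷ step 5 three k3 ∷ step 1 one k1 ∷ []) tt tt tt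
... | a3 k1 | b1 k2 | c4 k3 | d1 = realize (counts 3 1 4 1) (0 ∷ 1 ∷ 2 ∷ 5 ∷ 3 ∷ 6 ∷ 9 ∷ 8 ∷ 4 ∷ 7 ∷ []) (step 8 two k2 ∷ step 6 three k3 ∷ step 1 one k1 ∷ []) tt tt tt
... | a3 k1 | b1 k2 | c4 k3 | d2 k4 = realize (counts 3 1 4 2) (0 ∷ 1 ∷ 4 ∷ 7 ∷ 10 ∷ 6 ∷ 8 ∷ 9 ∷ 5 ∷ 2 ∷ 3 ∷ []) (step 7 four k4 ∷ step 4 two k2 ∷ step 3 three k3 ∷ step 1 one k1 ∷ []) tt tt tt
... | a3 k1 | b1 k2 | c4 k3 | d3 k4 = realize (counts 3 1 4 3) (0 ∷ 1 ∷ 4 ∷ 7 ∷ 11 ∷ 8 ∷ 6 ∷ 10 ∷ 9 ∷ 5 ∷ 2 ∷ 3 ∷ []) (step 7 four k4 ∷ step 4 two k2 ∷ step 3 three k3 ∷ step 1 one k1 ∷ []) tt tt tt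
... | a3 k1 | b1 k2 | c4 k3 | d4 k4 = realize (counts 3 1 4 4) (0 ∷ 1 ∷ 4 ∷ 3 ∷ 7 ∷ 9 ∷ 12 ∷ 8 ∷ 11 ∷ 10 ∷ 6 ∷ 2 ∷ 5 ∷ []) (step 9 four k4 ∷ step 6 two k2 ∷ step 5 three k3 ∷ step 1 one k1 ∷ []) tt tt tt
... | a3 k1 | b1 k2 | c4 k3 | d5 k4 = realize (counts 3 1 4 5) (0 ∷ 1 ∷ 4 ∷ 3 ∷ 7 ∷ 11 ∷ 12 ∷ 8 ∷ 10 ∷ 13 ∷ 9 ∷ 6 ∷ 2 ∷ 5 ∷ []) (step 9 four k4 ∷ step 6 two k2 ∷ step 5 three k3 ∷ step 1 one k1 ∷ []) tt tt tt
... | a3 k1 | b2 k2 | c1 | d1 = realize (counts 3 2 1 1) (0 ∷ 1 ∷ 2 ∷ 5 ∷ 3 ∷ 7 ∷ 6 ∷ 4 ∷ []) (step 6 two k2 ∷ step 1 one k1 ∷ []) tt tt tt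
... | a3 k1 | b2 k2 | c1 | d2 k4 = realize (counts 3 2 1 2) (0 ∷ 1 ∷ 3 ∷ 7 ∷ 8 ∷ 4 ∷ 6 ∷ 5 ∷ 2 ∷ []) (step 7 two k2 ∷ step 5 four k4 ∷ step 1 one k1 ∷ []) tt tt tt
... | a3 k1 | b2 k2 | c1 | d3 k4 = realize (counts 3 2 1 3) (0 ∷ 1 ∷ 3 ∷ 5 ∷ 9 ∷ 8 ∷ 4 ∷ 7 ∷ 6 ∷ 2 ∷ []) (step 8 two k2 ∷ step 5 four k4 ∷ step 1 one k1 ∷ []) tt tt tt
... | a3 k1 | b2 k2 | c1 | d4 k4 = realize (counts 3 2 1 4) (0 ∷ 1 ∷ 2 ∷ 6 ∷ 10 ∷ 9 ∷ 7 ∷ 3 ∷ 5 ∷ 8 ∷ 4 ∷ []) (step 9 two k2 ∷ step 5 four k4 ∷ step 1 one k1 ∷ []) tt tt tt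
... | a3 k1 | b2 k2 | c1 | d5 k4 = realize (counts 3 2 1 5) (0 ∷ 1 ∷ 2 ∷ 6 ∷ 9 ∷ 5 ∷ 3 ∷ 7 ∷ 11 ∷ 10 ∷ 8 ∷ 4 ∷ []) (step 10 two k2 ∷ step 5 four k4 ∷ step 1 one k1 ∷ []) tt tt tt
... | a3 k1 | b2 k2 | c2 k3 | d1 = realize (counts 3 2 2 1) (0 ∷ 1 ∷ 3 ∷ 4 ∷ 7 ∷ 8 ∷ 6 ∷ 2 ∷ 5 ∷ []) (step 6 two k2 ∷ step 4 three k3 ∷ step 1 one k1 ∷ []) tt tt tt
... | a3 k1 | b2 k2 | c2 k3 | d2 k4 = realize (counts 3 2 2 2) (2 ∷ 1 ∷ 5 ∷ 4 ∷ 0 ∷ 3 ∷ 6 ∷ 8 ∷ 9 ∷ 7 ∷ []) (step 8 two k2 ∷ step 6 one k1 ∷ step 3 three k3 ∷ step 2 four k4 ∷ []) tt tt tt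
... | a3 k1 | b2 k2 | c2 k3 | d3 k4 = realize (counts 3 2 2 3) (0 ∷ 1 ∷ 4 ∷ 8 ∷ 10 ∷ 6 ∷ 7 ∷ 9 ∷ 5 ∷ 2 ∷ 3 ∷ []) (step 7 four k4 ∷ step 4 two k2 ∷ step 3 three k3 ∷ step 1 one k1 ∷ []) tt tt tt
... | a3 k1 | b2 k2 | c2 k3 | d4 k4 = realize (counts 3 2 2 4) (0 ∷ 1 ∷ 3 ∷ 7 ∷ 11 ∷ 10 ∷ 6 ∷ 9 ∷ 8 ∷ 4 ∷ 2 ∷ 5 ∷ []) (step 10 two k2 ∷ step 7 four k4 ∷ step 3 three k3 ∷ step 1 one k1 ∷ []) tt tt tt
... | a3 k1 | b2 k2 | c2 k3 | d5 k4 = realize (counts 3 2 2 5) (0 ∷ 1 ∷ 3 ∷ 4 ∷ 8 ∷ 10 ∷ 6 ∷ 2 ∷ 5 ∷ 9 ∷ 12 ∷ 11 ∷ 7 ∷ []) (step 11 two k2 ∷ step 8 four k4 ∷ step 4 three k3 ∷ step 1 one k1 ∷ []) tt tt tt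
... | a3 k1 | b2 k2 | c3 k3 | d1 = realize (counts 3 2 3 1) (0 ∷ 1 ∷ 3 ∷ 4 ∷ 7 ∷ 9 ∷ 8 ∷ 5 ∷ 2 ∷ 6 ∷ []) (step 7 two k2 ∷ step 4 three k3 ∷ step 1 one k1 ∷ []) tt tt tt
... | a3 k1 | b2 k2 | c3 k3 | d2 k4 = realize (counts 3 2 3 2) (0 ∷ 2 ∷ 3 ∷ 1 ∷ 4 ∷ 7 ∷ 8 ∷ 5 ∷ 9 ∷ 10 ∷ 6 ∷ []) (step 9 two k2 ∷ step 7 four k4 ∷ step 4 one k1 ∷ step 2 three k3 ∷ []) tt tt tt
... | a3 k1 | b2 k2 | c3 k3 | d3 k4 = realize (counts 3 2 3 3) (0 ∷ 1 ∷ 3 ∷ 7 ∷ 11 ∷ 10 ∷ 6 ∷ 9 ∷ 8 ∷ 5 ∷ 2 ∷ 4 ∷ []) (step 10 two k2 ∷ step 7 four k4 ∷ step 3 three k3 ∷ step 1 one k1 ∷ []) tt tt tt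
... | a3 k1 | b2 k2 | c3 k3 | d4 k4 = realize (counts 3 2 3 4) (0 ∷ 1 ∷ 3 ∷ 4 ∷ 8 ∷ 10 ∷ 7 ∷ 11 ∷ 12 ∷ 9 ∷ 5 ∷ 2 ∷ 6 ∷ []) (step 11 two k2 ∷ step 8 four k4 ∷ step 4 three k3 ∷ step 1 one k1 ∷ []) tt tt tt
... | a3 k1 | b2 k2 | c3 k3 | d5 k4 = realize (counts 3 2 3 5) (0 ∷ 1 ∷ 3 ∷ 4 ∷ 7 ∷ 11 ∷ 9 ∷ 5 ∷ 2 ∷ 6 ∷ 10 ∷ 13 ∷ 12 ∷ 8 ∷ []) (step 12 two k2 ∷ step 9 four k4 ∷ step 4 three k3 ∷ step 1 one k1 ∷ []) tt tt tt
... | a3 k1 | b2 k2 | c4 k3 | d1 = realize (counts 3 2 4 1) (0 ∷ 1 ∷ 2 ∷ 4 ∷ 8 ∷ 5 ∷ 3 ∷ 6 ∷ 9 ∷ 10 ∷ 7 ∷ []) (step 9 two k2 ∷ step 4 three k3 ∷ step 1 one k1 ∷ []) tt tt tt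
... | a3 k1 | b2 k2 | c4 k3 | d2 k4 = realize (counts 3 2 4 2) (0 ∷ 1 ∷ 4 ∷ 6 ∷ 8 ∷ 11 ∷ 7 ∷ 10 ∷ 9 ∷ 5 ∷ 2 ∷ 3 ∷ []) (step 8 four k4 ∷ step 4 two k2 ∷ step 3 three k3 ∷ step 1 one k1 ∷ []) tt tt tt
... | a3 k1 | b2 k2 | c4 k3 | d3 k4 = realize (counts 3 2 4 3) (0 ∷ 1 ∷ 3 ∷ 4 ∷ 7 ∷ 9 ∷ 12 ∷ 8 ∷ 11 ∷ 10 ∷ 6 ∷ 2 ∷ 5 ∷ []) (step 9 four k4 ∷ step 6 two k2 ∷ step 4 three k3 ∷ step 1 one k1 ∷ []) tt tt tt
... | a3 k1 | b2 k2 | c4 k3 | d4 k4 = realize (counts 3 2 4 4) (0 ∷ 1 ∷ 3 ∷ 4 ∷ 7 ∷ 11 ∷ 12 ∷ 8 ∷ 10 ∷ 13 ∷ 9 ∷ 6 ∷ 2 ∷ 5 ∷ []) (step 9 four k4 ∷ step 6 two k2 ∷ step 4 three k3 ∷ step 1 one k1 ∷ []) tt tt tt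
... | a3 k1 | b2 k2 | c4 k3 | d5 k4 = realize (counts 3 2 4 5) (0 ∷ 1 ∷ 2 ∷ 4 ∷ 8 ∷ 12 ∷ 9 ∷ 5 ∷ 3 ∷ 6 ∷ 10 ∷ 13 ∷ 14 ∷ 11 ∷ 7 ∷ []) (step 13 two k2 ∷ step 8 four k4 ∷ step 4 three k3 ∷ step 1 one k1 ∷ []) tt tt tt

-- The theorem: the linear realization is a cyclic one, because admissibility bounds
-- every prescribed length by ⌊v/2⌋.

theorem1p8 : (a b c d : ℕ) → 1 ≤ c → 1 ≤ d →
    Admissible (a + b + c + d + 1) (L1234 a b c d) →
    (3 ≤ a ⊎ (a ≡ 2 × 1 ≤ b)) →
    Σ (List ℕ) (λ H → IsHamiltonianPath (a + b + c + d + 1) H ×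
      (pathLengths (a + b + c + d + 1) H ↭ L1234 a b c d))
theorem1p8 a b c d c≥1 d≥1 (_ , bounded , _) cond with linear-realization a b c d c≥1 d≥1 cond
... | H , hamiltonian , diffs↭L = H , hamiltonian , subst (_↭ L1234 a b c d) (sym pathLengths≡diffs) diffs↭L
  where
  pathLengths≡diffs : pathLengths (a + b + c + d + 1) H ≡ diffs H
  pathLengths≡diffs = pathLengths-short _ H (All-resp-↭ (↭-sym diffs↭L) (All.map proj₂ bounded))
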